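{- Consider an execution of the algorithm described below. Let $1\le i\le k$. For every $u\in D_i$, every $v\in V$, and every path $p$ in $G$ between $u$ and $v$, \[ d_G(u,v)\le \hat\delta_i(u,v)\le w(p)+2(i-1)\cdot W(p).\]
   Context: Input: an undirected graph $G=(V,E,w)$ with non-negative weights, $n$ vertices, $m$ edges, and an integer $2\le k=O(\log n)$; $d_G$ is the shortest-path distance in $G$. For a vertex $u$ and integer $s$, $L_s(u)$ is the set of $s$ lightest neighbors of $u$ (the neighbors joined to $u$ by one of the $s$ lightest edges incident to $u$). For $i=1,\dots,k-1$: $s_i=(m/n)^{1-i/k}$; $A_i=\{v\in V:\deg(v)\ge s_i\}$; $D_i\subseteq V$ is a set (computed by a greedy hitting set algorithm) intersecting $L_{s_i}(v)$ for every $v\in A_i$; $E_{i+1}=\{\{u,v\}\in E: v\in L_{s_i}(u)\}$. Also $E_1=E$ and $D_k=V$. Initialize an $n\times n$ matrix $\hat\delta(u,v)=w(u,v)$ if $\{u,v\}\in E$ and $\infty$ otherwise. Then for $i=1,\dots,k$ and for each $u\in D_i$, run Dijkstra's algorithm from $u$ on the graph with vertex set $V$ and edge set $E_i\cup(\{u\}\times V)$, where each edge $\{a,b\}$ has weight equal to the current value $\hat\delta(a,b)$; afterwards, for every $v$, the entries $\hat\delta(u,v)$ and $\hat\delta(v,u)$ are replaced by the computed distance from $u$ to $v$ whenever it is smaller. $\hat\delta_i$ denotes the matrix after the Dijkstra runs for all $u\in D_i$ in iteration $i$ have been performed. For a path $p$, $w(p)$ is its total weight and $W(p)$ is the maximum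 weight of an edge on $p$.
   Formalization: The edge weights of $G$ are non-negative rationals rather than non-negative reals, so the entries of $\hat\delta$ are rational or ∞. -}

module Defs where

open import Data.Nat as ℕ using (ℕ; zero; suc; _≤_; _<_; _^_; _∸_)
import Data.Nat.Properties as ℕP
open import Data.Integer using (+_)
open import Data.Rational as ℚ using (ℚ; 0ℚ; _/_)
open import Data.Fin using (Fin; toℕ; _≟_)
open import Data.List using (List; []; _∷_; map; allFin)
open import Data.Nat.ListAction using (sum)
open import Data.List.Membership.Propositional using (_∈_)
open import Data.List.Relation.Unary.Unique.Propositional using (Unique)
open import Data.Maybe using (Maybe; just; nothing; is-just)
open import Data.Bool using (Bool; true; false; if_then_else_; _∧_; _∨_)
open import Data.Product using (Σ; _×_; _,_)
open import Data.Sum using (_⊎_)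
open import Relation.Binary.PropositionalEquality using (_≡_)
open import Relation.Nullary.Decidable using (isYes)

data ℚ∞ : Set where
  fin : ℚ → ℚ∞
  ∞   : ℚ∞

infix 4 _≤∞_
data _≤∞_ : ℚ∞ → ℚ∞ → Set where
  fin≤fin : ∀ {p q} → p ℚ.≤ q → fin p ≤∞ fin q
  _≤∞∞    : ∀ x → x ≤∞ ∞

infixl 6 _+∞_
_+∞_ : ℚ∞ → ℚ∞ → ℚ∞
fin p +∞ fin q = fin (p ℚ.+ q)
fin p +∞ ∞     = ∞
∞     +∞ _     = ∞

min∞ : ℚ∞ → ℚ∞ → ℚ∞
min∞ (fin p) (fin q) = fin (p ℚ.⊓ q)
min∞ (fin p) ∞       = fin p
min∞ ∞       y       = y

count : ∀ {n} → (Fin n → Bool) → ℕ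
count {n} f = sum (map (λ v → if f v then 1 else 0) (allFin n))

-- Undirected simple graphs on vertex set Fin n with non-negative weights.
-- w u v ≡ just q  means {u,v} ∈ E with weight q;  nothing means no edge.

record Graph (n : ℕ) : Set where
  field
    w        : Fin n → Fin n → Maybe ℚ
    sym      : ∀ u v → w u v ≡ w v u
    loopless : ∀ u → w u u ≡ nothing
    nonneg   : ∀ u v q → w u v ≡ just q → 0ℚ ℚ.≤ q

module _ {n : ℕ} (G : Graph n) where
  open Graph G

  isEdge : Fin n → Fin n → Bool
  isEdge u v = is-just (w u v)

  deg : Fin n → ℕ
  deg u = count (isEdge u)

  numEdges : ℕ
  numEdges = sum (map (λ u → count (λ v → isYes (toℕ u ℕ.<? toℕ v) ∧ isEdge u v)) (allFin n))

  wt∞ : Fin n → Fin n → ℚ∞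
  wt∞ u v with w u v
  ... | just q  = fin q
  ... | nothing = ∞

  data Path : Fin n → Fin n → Set where
    here : (a : Fin n) → Path a a
    step : (a : Fin n) {b c : Fin n} (q : ℚ) → w a b ≡ just q → Path b c → Path a c

  pathWeight : ∀ {a c} → Path a c → ℚ
  pathWeight (here a)         = 0ℚ
  pathWeight (step a q _ p)   = q ℚ.+ pathWeight p

  pathMax : ∀ {a c} → Path a c → ℚ
  pathMax (here a)        = 0ℚ
  pathMax (step a q _ p)  = q ℚ.⊔ pathMax p

  -- L : Fin n → Fin n → Bool  is a valid choice of  L_s(u) = s lightest neighbours of u
  -- (L u v ≡ true  means  v ∈ L_s(u)).
  IsLightest : ℕ → (Fin n → Fin n → Bool) → Set
  IsLightest s L = ∀ u →
      (∀ v → L u v ≡ true → isEdge u v ≡ true)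
    × count (L u) ≡ s ℕ.⊓ deg u
    × (∀ v v' → L u v ≡ true → L u v' ≡ false → isEdge u v' ≡ true → wt∞ u v ≤∞ wt∞ u v')

Matrix : ℕ → Set
Matrix n = Fin n → Fin n → ℚ∞

data Walk {n : ℕ} : Fin n → Fin n → Set where
  here : (a : Fin n) → Walk a a
  step : (a : Fin n) {b c : Fin n} → Walk b c → Walk a c

walkWeight : ∀ {n} → Matrix n → ∀ {a c} → Walk {n} a c → ℚ∞
walkWeight H (here a)         = fin 0ℚ
walkWeight H (step a {b} p)   = H a b +∞ walkWeight H p

IsDist : ∀ {n} → Matrix n → Fin n → Fin n → ℚ∞ → Set
IsDist H u v d = (∀ (p : Walk u v) → d ≤∞ walkWeight H p)
               × (d ≡ ∞ ⊎ Σ (Walk u v) (λ p → walkWeight H p ≡ d))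

IsDistG : ∀ {n} → Graph n → Fin n → Fin n → ℚ∞ → Set
IsDistG G = IsDist (wt∞ G)

-- One Dijkstra run from u on (V, Ei ∪ ({u} × V)) with weights from the
-- current matrix M, followed by the update of row/column u; result M'.

auxGraph : ∀ {n} → (Fin n → Fin n → Bool) → Fin n → Matrix n → Matrix n
auxGraph Ei u M a b =
  if Ei a b ∨ isYes (a ≟ u) ∨ isYes (b ≟ u) then M a b else ∞

updateWith : ∀ {n} → Fin n → (Fin n → ℚ∞) → Matrix n → Matrix n
updateWith u dist M x y =
  if isYes (x ≟ u) then min∞ (M x y) (dist y)
  else if isYes (y ≟ u) then min∞ (M x y) (dist x)
  else M x y

DijkstraStep : ∀ {n} → (Fin n → Fin n → Bool) → Fin n → Matrix n → Matrix n → Set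
DijkstraStep {n} Ei u M M' =
  Σ (Fin n → ℚ∞) λ dist →
    (∀ v → IsDist (auxGraph Ei u M) u v (dist v)) × (M' ≡ updateWith u dist M)

data Runs {n : ℕ} (Ei : Fin n → Fin n → Bool) : List (Fin n) → Matrix n → Matrix n → Set where
  done : ∀ {M} → Runs Ei [] M M
  run  : ∀ {u us M M₁ M₂} → DijkstraStep Ei u M M₁ → Runs Ei us M₁ M₂ → Runs Ei (u ∷ us) M M₂

-- s_i = (m/n)^(1-i/k); s is the integer ⌈s_i⌉ (so deg v ≥ s_i ⇔ deg v ≥ s,
-- and L_{s_i} consists of ⌈s_i⌉ lightest neighbours), characterised exactly:
-- s is the least natural number with  m^(k-i) ≤ s^k · n^(k-i).
IsCeilS : (n m k i s : ℕ) → Set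
IsCeilS n m k i s =
    m ^ (k ∸ i) ≤ s ^ k ℕ.* n ^ (k ∸ i)
  × (∀ t → m ^ (k ∸ i) ≤ t ^ k ℕ.* n ^ (k ∸ i) → s ≤ t)

-- An execution of the algorithm on G with parameter k.
-- Iterations are indexed by i : ℕ with 1 ≤ i ≤ k (values outside are unused).

module _ {n : ℕ} (G : Graph n) where

  -- E_i given the lightest-neighbour choices L (L i = L_{s_i}):
  -- E_1 = E,  E_{i+1} = {{u,v} ∈ E : v ∈ L_{s_i}(u)} (as an undirected edge set)
  Eset : (ℕ → Fin n → Fin n → Bool) → ℕ → Fin n → Fin n → Bool
  Eset L zero          a b = false
  Eset L (suc zero)    a b = isEdge G a b
  Eset L (suc (suc j)) a b = L (suc j) a b ∨ L (suc j) b a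

  record Execution (k : ℕ) : Set where
    field
      s    : ℕ → ℕ
      s-ok : ∀ i → 1 ≤ i → i < k → IsCeilS n (numEdges G) k i (s i)
      L    : ℕ → Fin n → Fin n → Bool
      L-ok : ∀ i → 1 ≤ i → i < k → IsLightest G (s i) (L i)
      -- D i : the set D_i, listed in the order in which Dijkstra is run
      D       : ℕ → List (Fin n)
      D-uniq  : ∀ i → 1 ≤ i → i ≤ k → Unique (D i)
      D-hit   : ∀ i → 1 ≤ i → i < k → ∀ v → s i ≤ deg G v →
                  Σ (Fin n) λ x → x ∈ D i × L i v x ≡ true
      D-last  : ∀ v → v ∈ D k
      δ̂       : ℕ → Matrix n
      δ̂-init  : δ̂ 0 ≡ wt∞ G
      δ̂-step  : ∀ i → 1 ≤ i → i ≤ k → Runs (Eset L i) (D i) (δ̂ (i ∸ 1)) (δ̂ i)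

-- Lower bound: every entry of δ̂ stays symmetric and is either ∞ or at least the weight of a
-- walk of G, since Dijkstra only combines entries along walks and takes minima.
-- Upper bound, by induction on i: after the run from u ∈ D_i, δ̂(u,v) is at most the weight of
-- any u–v walk in E_i ∪ ({u} × V) under the matrix at that moment. If p lies in E_i this is p
-- itself. Otherwise let {c,b} be the last edge of p outside E_i; then c ∉ L_{s_{i-1}}(b), so
-- deg b ≥ s_{i-1} and some x ∈ D_{i-1} ∩ L_{s_{i-1}}(b) has w(b,x) ≤ w(b,c) ≤ W(p). Take the
-- walk u → x → b → (rest of p): its first edge weighs at most δ̂_{i-1}(u,x) = δ̂_{i-1}(x,u), bounded
-- by induction along the path x, b, c, …, u, and the detour through x adds 2·w(b,x) ≤ 2·W(p).

module Submission where

open import Defs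
open import Data.Nat using (ℕ; _≤_; _*_; _∸_)
open import Data.Integer using (+_)
open import Data.Rational using (_/_) renaming (_+_ to _+ℚ_; _*_ to _*ℚ_)
open import Data.Fin using (Fin)
open import Data.List.Membership.Propositional using (_∈_)
open import Data.Product using (_×_)

open import Data.Nat as ℕ using (zero; suc; z≤n; s≤s; _<_)
import Data.Nat.Properties as ℕP
import Data.Integer.Solver as ℤSolver
open import Data.Rational as ℚ using (ℚ; 0ℚ; 1ℚ; toℚᵘ)
import Data.Rational.Properties as ℚP
import Data.Rational.Solver as ℚSolver
open import Data.Rational.Unnormalised as ℚᵘ using (mkℚᵘ; 1ℚᵘ; *≡*)
import Data.Rational.Unnormalised.Properties as ℚᵘP
open import Data.Fin using (_≟_)
open import Data.List using ([]; _∷_; map)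
open import Data.Nat.ListAction using (sum)
open import Data.List.Relation.Unary.Any using (here; there)
open import Data.List.Membership.Propositional.Properties using (∈-allFin)
open import Data.Maybe using (Maybe; just; is-just)
open import Data.Bool using (Bool; true; false; if_then_else_; _∨_)
open import Data.Bool.Properties using (∨-conicalʳ; ∨-zeroʳ)
open import Data.Product using (Σ; ∃; _,_; proj₁; proj₂)
open import Data.Sum as Sum using (_⊎_; inj₁; inj₂; [_,_]′)
open import Data.Unit using (⊤; tt)
open import Relation.Binary.Bundles using (Preorder)
import Relation.Binary.Reasoning.Preorder
open import Relation.Binary.PropositionalEquality
  using (_≡_; refl; sym; trans; cong; cong₂; subst; subst₂; isEquivalence; module ≡-Reasoning)
open import Relation.Nullary using (yes; no; contradiction)
open import Relation.Nullary.Decidable using (isYes)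

≤∞-refl : ∀ {x} → x ≤∞ x
≤∞-refl {fin p} = fin≤fin ℚP.≤-refl
≤∞-refl {∞}     = ∞ ≤∞∞

≤∞-reflexive : ∀ {x y} → x ≡ y → x ≤∞ y
≤∞-reflexive refl = ≤∞-refl

≤∞-trans : ∀ {x y z} → x ≤∞ y → y ≤∞ z → x ≤∞ z
≤∞-trans (fin≤fin p≤q) (fin≤fin q≤r) = fin≤fin (ℚP.≤-trans p≤q q≤r)
≤∞-trans {x} _         (_ ≤∞∞)       = x ≤∞∞

≤∞-preorder : Preorder _ _ _
≤∞-preorder = record
  { isPreorder = record
    { isEquivalence = isEquivalence
    ; reflexive     = ≤∞-reflexive
    ; trans         = ≤∞-trans
    }
  }

module ≤∞-Reasoning = Relation.Binary.Reasoning.Preorder ≤∞-preorder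

fin≤fin⁻¹ : ∀ {p q} → fin p ≤∞ fin q → p ℚ.≤ q
fin≤fin⁻¹ (fin≤fin p≤q) = p≤q

+∞-mono-≤ : ∀ {x x′ y y′} → x ≤∞ x′ → y ≤∞ y′ → x +∞ y ≤∞ x′ +∞ y′
+∞-mono-≤ (fin≤fin p≤p′) (fin≤fin q≤q′) = fin≤fin (ℚP.+-mono-≤ p≤p′ q≤q′)
+∞-mono-≤ {x} {y = y} (fin≤fin _) (_ ≤∞∞) = (x +∞ y) ≤∞∞
+∞-mono-≤ {x} {y = y} (_ ≤∞∞)     _       = (x +∞ y) ≤∞∞

+∞-identityˡ : ∀ x → fin 0ℚ +∞ x ≡ x
+∞-identityˡ (fin p) = cong fin (ℚP.+-identityˡ p)
+∞-identityˡ ∞       = refl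

+∞-identityʳ : ∀ x → x +∞ fin 0ℚ ≡ x
+∞-identityʳ (fin p) = cong fin (ℚP.+-identityʳ p)
+∞-identityʳ ∞       = refl

+∞-zeroʳ : ∀ x → x +∞ ∞ ≡ ∞
+∞-zeroʳ (fin p) = refl
+∞-zeroʳ ∞       = refl

+∞-assoc : ∀ x y z → (x +∞ y) +∞ z ≡ x +∞ (y +∞ z)
+∞-assoc (fin p) (fin q) (fin r) = cong fin (ℚP.+-assoc p q r)
+∞-assoc (fin p) (fin q) ∞       = refl
+∞-assoc (fin p) ∞       z       = refl
+∞-assoc ∞       y       z       = refl

+∞-comm : ∀ x y → x +∞ y ≡ y +∞ x
+∞-comm (fin p) (fin q) = cong fin (ℚP.+-comm p q)
+∞-comm (fin p) ∞       = refl
+∞-comm ∞       (fin q) = refl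
+∞-comm ∞       ∞       = refl

min∞-≤ˡ : ∀ x y → min∞ x y ≤∞ x
min∞-≤ˡ (fin p) (fin q) = fin≤fin (ℚP.p⊓q≤p p q)
min∞-≤ˡ (fin p) ∞       = ≤∞-refl
min∞-≤ˡ ∞       y       = y ≤∞∞

min∞-≤ʳ : ∀ x y → min∞ x y ≤∞ y
min∞-≤ʳ (fin p) (fin q) = fin≤fin (ℚP.p⊓q≤q p q)
min∞-≤ʳ (fin p) ∞       = fin p ≤∞∞
min∞-≤ʳ ∞       y       = ≤∞-refl

min∞-sel : ∀ x y → min∞ x y ≡ x ⊎ min∞ x y ≡ y
min∞-sel (fin p) (fin q) = Sum.map (cong fin) (cong fin) (ℚP.⊓-sel p q)
min∞-sel (fin p) ∞       = inj₁ refl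
min∞-sel ∞       y       = inj₂ refl

infixr 5 _++ʷ_
_++ʷ_ : ∀ {n} {a b c : Fin n} → Walk a b → Walk b c → Walk a c
here _   ++ʷ t = t
step a s ++ʷ t = step a (s ++ʷ t)

walkWeight-++ : ∀ {n} (H : Matrix n) {a b c} (s : Walk a b) (t : Walk b c) →
                walkWeight H (s ++ʷ t) ≡ walkWeight H s +∞ walkWeight H t
walkWeight-++ H (here _)       t = sym (+∞-identityˡ _)
walkWeight-++ H (step a {b} s) t =
  trans (cong (H a b +∞_) (walkWeight-++ H s t)) (sym (+∞-assoc (H a b) _ _))

reverseʷ : ∀ {n} {a c : Fin n} → Walk a c → Walk c a
reverseʷ (here a)       = here a
reverseʷ (step a {b} t) = reverseʷ t ++ʷ step b (here a)

IsSymmetric : ∀ {n} → Matrix n → Set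
IsSymmetric M = ∀ a b → M a b ≡ M b a

walkWeight-reverse : ∀ {n} {H : Matrix n} → IsSymmetric H → ∀ {a c} (t : Walk a c) →
                     walkWeight H (reverseʷ t) ≡ walkWeight H t
walkWeight-reverse         H-sym (here a)       = refl
walkWeight-reverse {H = H} H-sym (step a {b} t) = begin
  walkWeight H (reverseʷ t ++ʷ step b (here a))  ≡⟨ walkWeight-++ H (reverseʷ t) _ ⟩
  walkWeight H (reverseʷ t) +∞ (H b a +∞ fin 0ℚ) ≡⟨ cong₂ _+∞_ (walkWeight-reverse H-sym t)
                                                          (trans (+∞-identityʳ _) (H-sym b a)) ⟩
  walkWeight H t +∞ H a b                        ≡⟨ +∞-comm _ _ ⟩
  H a b +∞ walkWeight H t                        ∎
  where open ≡-Reasoning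

_⊑_ : ∀ {n} → Matrix n → Matrix n → Set
M ⊑ M′ = ∀ a b → M a b ≤∞ M′ a b

⊑-refl : ∀ {n} {M : Matrix n} → M ⊑ M
⊑-refl a b = ≤∞-refl

⊑-trans : ∀ {n} {M₁ M₂ M₃ : Matrix n} → M₁ ⊑ M₂ → M₂ ⊑ M₃ → M₁ ⊑ M₃
⊑-trans M₁⊑M₂ M₂⊑M₃ a b = ≤∞-trans (M₁⊑M₂ a b) (M₂⊑M₃ a b)

module _ {n : ℕ} (u : Fin n) (dist : Fin n → ℚ∞) (M : Matrix n) where

  updateWith-row : ∀ v → updateWith u dist M u v ≤∞ dist v
  updateWith-row v with u ≟ u
  ... | yes _  = min∞-≤ʳ _ _
  ... | no u≢u = contradiction refl u≢u

  updateWith-symmetric : IsSymmetric M → IsSymmetric (updateWith u dist M)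
  updateWith-symmetric M-sym x y with x ≟ u | y ≟ u
  ... | yes refl | yes refl = refl
  ... | yes _    | no _     = cong (λ z → min∞ z (dist y)) (M-sym x y)
  ... | no _     | yes _    = cong (λ z → min∞ z (dist x)) (M-sym x y)
  ... | no _     | no _     = M-sym x y

  updateWith-elim : (P : Fin n → Fin n → ℚ∞ → Set) → (∀ x y → P x y (M x y)) →
                    (∀ y → P u y (min∞ (M u y) (dist y))) → (∀ x → P x u (min∞ (M x u) (dist x))) →
                    ∀ x y → P x y (updateWith u dist M x y)
  updateWith-elim P keep row column x y with x ≟ u | y ≟ u
  ... | yes refl | _        = row y
  ... | no _     | yes refl = column x
  ... | no _     | no _     = keep x y

  updateWith-⊑ : updateWith u dist M ⊑ M
  updateWith-⊑ = updateWith-elim (λ x y z → z ≤∞ M x y)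
    (λ _ _ → ≤∞-refl) (λ y → min∞-≤ˡ (M u y) (dist y)) (λ x → min∞-≤ˡ (M x u) (dist x))

auxGraph-row : ∀ {n} (Ei : Fin n → Fin n → Bool) u M b → auxGraph Ei u M u b ≡ M u b
auxGraph-row Ei u M b with Ei u b | u ≟ u
... | true  | _      = refl
... | false | yes _  = refl
... | false | no u≢u = contradiction refl u≢u

auxGraph-edge : ∀ {n} (Ei : Fin n → Fin n → Bool) {a b} u M → Ei a b ≡ true → auxGraph Ei u M a b ≡ M a b
auxGraph-edge Ei u M ab∈Ei rewrite ab∈Ei = refl

dijkstraStep-⊑ : ∀ {n} (Ei : Fin n → Fin n → Bool) {u M M′} → DijkstraStep Ei u M M′ → M′ ⊑ M
dijkstraStep-⊑ Ei {u} {M} (dist , _ , refl) = updateWith-⊑ u dist M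

runs-preserves : ∀ {n} {Ei : Fin n → Fin n → Bool} (P : Matrix n → Set) →
                 (∀ Ei {u M M′} → DijkstraStep Ei u M M′ → P M → P M′) →
                 ∀ {us M M′} → Runs Ei us M M′ → P M → P M′
runs-preserves P step-P done        PM = PM
runs-preserves {Ei = Ei} P step-P (run st rs) PM = runs-preserves P step-P rs (step-P Ei st PM)

runs-⊑ : ∀ {n} {Ei : Fin n → Fin n → Bool} {us M M′} → Runs Ei us M M′ → M′ ⊑ M
runs-⊑ {Ei = Ei} {M = M} rs =
  runs-preserves (_⊑ M) (λ Ei st M₁⊑M → ⊑-trans (dijkstraStep-⊑ Ei st) M₁⊑M) rs ⊑-refl

-- Mᵤ is the matrix at the moment the run from u starts.
runs-row-bound : ∀ {n} {Ei : Fin n → Fin n → Bool} {u us M M′} → Runs Ei us M M′ → u ∈ us →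
                 Σ (Matrix n) λ Mᵤ → Mᵤ ⊑ M ×
                   (∀ {v} (t : Walk u v) → M′ u v ≤∞ walkWeight (auxGraph Ei u Mᵤ) t)
runs-row-bound {u = u} {M = M} (run (dist , isDist , refl) rs) (here refl) =
  M , ⊑-refl , λ {v} t → ≤∞-trans (runs-⊑ rs u v)
                          (≤∞-trans (updateWith-row u dist M v) (proj₁ (isDist v) t))
runs-row-bound {Ei = Ei} (run st rs) (there u∈us) with runs-row-bound rs u∈us
... | Mᵤ , Mᵤ⊑ , bound = Mᵤ , ⊑-trans Mᵤ⊑ (dijkstraStep-⊑ Ei st) , bound

indicator : Bool → ℕ
indicator b = if b then 1 else 0

indicator-mono : ∀ {b c} → (b ≡ true → c ≡ true) → indicator b ≤ indicator c
indicator-mono {false} _   = z≤n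
indicator-mono {true}  b⇒c rewrite b⇒c refl = ℕP.≤-refl

sum-map-mono-≤ : ∀ {A : Set} {f g : A → ℕ} → (∀ x → f x ≤ g x) → ∀ xs → sum (map f xs) ≤ sum (map g xs)
sum-map-mono-≤ f≤g []       = z≤n
sum-map-mono-≤ f≤g (x ∷ xs) = ℕP.+-mono-≤ (f≤g x) (sum-map-mono-≤ f≤g xs)

sum-map-mono-< : ∀ {A : Set} {f g : A → ℕ} → (∀ x → f x ≤ g x) →
                 ∀ {a xs} → a ∈ xs → f a < g a → sum (map f xs) < sum (map g xs)
sum-map-mono-< f≤g {xs = x ∷ xs} (here refl) fa<ga = ℕP.+-mono-<-≤ fa<ga (sum-map-mono-≤ f≤g xs)
sum-map-mono-< f≤g {xs = x ∷ xs} (there a∈xs) fa<ga = ℕP.+-mono-≤-< (f≤g x) (sum-map-mono-< f≤g a∈xs fa<ga)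

count-< : ∀ {n} {f g : Fin n → Bool} → (∀ v → f v ≡ true → g v ≡ true) →
          ∀ {a} → f a ≡ false → g a ≡ true → count f < count g
count-< f⊆g {a} fa≡false ga≡true =
  sum-map-mono-< (λ v → indicator-mono (f⊆g v)) (∈-allFin a)
    (subst₂ (λ x y → indicator x < indicator y) (sym fa≡false) (sym ga≡true) ℕP.≤-refl)

m⊓n<n⇒m≤n : ∀ m n → m ℕ.⊓ n < n → m ≤ n
m⊓n<n⇒m≤n m n m⊓n<n with ℕP.≤-total m n
... | inj₁ m≤n = m≤n
... | inj₂ n≤m = contradiction (subst (_< n) (ℕP.m≥n⇒m⊓n≡n n≤m) m⊓n<n) (ℕP.<-irrefl refl)

lightest-excludes⇒s≤deg : ∀ {n} {G : Graph n} {s L} → IsLightest G s L →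
                          ∀ {u c} → isEdge G u c ≡ true → L u c ≡ false → s ≤ deg G u
lightest-excludes⇒s≤deg {G = G} {s} {L} lightest {u} uc∈E c∉L =
  m⊓n<n⇒m≤n s (deg G u) (subst (_< deg G u) |L|≡s⊓deg (count-< L⊆E c∉L uc∈E))
  where
  L⊆E = proj₁ (lightest u)
  |L|≡s⊓deg = proj₁ (proj₂ (lightest u))

/1-suc : ∀ m → + suc m / 1 ≡ 1ℚ +ℚ + m / 1
/1-suc m = ℚP.toℚᵘ-injective (begin
  toℚᵘ (+ suc m / 1)          ≈⟨ ℚP.toℚᵘ-fromℚᵘ (mkℚᵘ (+ suc m) 0) ⟩
  mkℚᵘ (+ suc m) 0            ≈⟨ *≡* (solve 1 (λ x → (con (+ 1) :+ x) :* con (+ 1)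
                                      := (con (+ 1) :* con (+ 1) :+ x :* con (+ 1)) :* con (+ 1)) refl (+ m)) ⟩
  1ℚᵘ ℚᵘ.+ mkℚᵘ (+ m) 0       ≈⟨ ℚᵘP.+-congʳ 1ℚᵘ (ℚᵘP.≃-sym (ℚP.toℚᵘ-fromℚᵘ (mkℚᵘ (+ m) 0))) ⟩
  toℚᵘ 1ℚ ℚᵘ.+ toℚᵘ (+ m / 1) ≈⟨ ℚᵘP.≃-sym (ℚP.toℚᵘ-homo-+ 1ℚ (+ m / 1)) ⟩
  toℚᵘ (1ℚ +ℚ + m / 1)        ∎)
  where
  open ℚᵘP.≃-Reasoning
  open ℤSolver.+-*-Solver

twice : ℕ → ℚ
twice j = + (2 * j) / 1

twice-nonNeg : ∀ j → ℚ.NonNegative (twice j)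
twice-nonNeg j = ℚP.normalize-nonNeg (2 * j) 1

twice-suc-* : ∀ j W → twice (suc j) *ℚ W ≡ twice j *ℚ W +ℚ (W +ℚ W)
twice-suc-* j W = begin
  twice (suc j) *ℚ W                   ≡⟨ cong (λ m → + m / 1 *ℚ W) (ℕP.*-suc 2 j) ⟩
  + suc (suc (2 * j)) / 1 *ℚ W         ≡⟨ cong (_*ℚ W) (trans (/1-suc (suc (2 * j)))
                                                             (cong (1ℚ +ℚ_) (/1-suc (2 * j)))) ⟩
  (1ℚ +ℚ (1ℚ +ℚ twice j)) *ℚ W         ≡⟨ solve 2 (λ c w → (con 1ℚ :+ (con 1ℚ :+ c)) :* w := c :* w :+ (w :+ w))
                                                refl (twice j) W ⟩
  twice j *ℚ W +ℚ (W +ℚ W)             ∎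
  where
  open ≡-Reasoning
  open ℚSolver.+-*-Solver

twice-*-mono-≤ : ∀ j {V W} → V ℚ.≤ W → twice j *ℚ V ℚ.≤ twice j *ℚ W
twice-*-mono-≤ j = ℚP.*-monoˡ-≤-nonNeg (twice j) {{twice-nonNeg j}}

≤-+-twice-* : ∀ j p {W} → 0ℚ ℚ.≤ W → p ℚ.≤ p +ℚ twice j *ℚ W
≤-+-twice-* j p {W} 0≤W = ℚP.≤-trans (ℚP.≤-reflexive (sym (ℚP.+-identityʳ p)))
  (ℚP.+-monoʳ-≤ p (ℚP.≤-trans (ℚP.≤-reflexive (sym (ℚP.*-zeroʳ (twice j)))) (twice-*-mono-≤ j 0≤W)))

-- q is w(b,x): the detour through x uses the edge {b,x} twice.
detour-≤ : ∀ j {q W back rest} → q ℚ.≤ W →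
           (q +ℚ back +ℚ twice j *ℚ W) +ℚ (q +ℚ rest) ℚ.≤ (back +ℚ rest) +ℚ twice (suc j) *ℚ W
detour-≤ j {q} {W} {back} {rest} q≤W = begin
  (q +ℚ back +ℚ twice j *ℚ W) +ℚ (q +ℚ rest)   ≡⟨ regroup q back (twice j *ℚ W) rest ⟩
  (back +ℚ rest) +ℚ (twice j *ℚ W +ℚ (q +ℚ q)) ≤⟨ ℚP.+-monoʳ-≤ (back +ℚ rest)
                                                    (ℚP.+-monoʳ-≤ (twice j *ℚ W) (ℚP.+-mono-≤ q≤W q≤W)) ⟩
  (back +ℚ rest) +ℚ (twice j *ℚ W +ℚ (W +ℚ W)) ≡⟨ cong ((back +ℚ rest) +ℚ_) (sym (twice-suc-* j W)) ⟩
  (back +ℚ rest) +ℚ twice (suc j) *ℚ W         ∎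
  where
  open ℚP.≤-Reasoning
  regroup : ∀ q b c r → (q +ℚ b +ℚ c) +ℚ (q +ℚ r) ≡ (b +ℚ r) +ℚ (c +ℚ (q +ℚ q))
  regroup = solve 4 (λ q b c r → (q :+ b :+ c) :+ (q :+ r) := (b :+ r) :+ (c :+ (q :+ q))) refl
    where open ℚSolver.+-*-Solver

is-just⇒just : ∀ {A : Set} (m : Maybe A) → is-just m ≡ true → ∃ λ a → m ≡ just a
is-just⇒just (just a) _ = a , refl

module _ {n : ℕ} (G : Graph n) where
  open Graph G renaming (sym to w-sym)

  wt∞-just : ∀ {a b q} → w a b ≡ just q → wt∞ G a b ≡ fin q
  wt∞-just e rewrite e = refl

  wt∞-symmetric : IsSymmetric (wt∞ G)
  wt∞-symmetric a b rewrite w-sym a b = refl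

  Realised : Fin n → Fin n → ℚ∞ → Set
  Realised a c X = X ≡ ∞ ⊎ Σ (Walk a c) λ t → walkWeight (wt∞ G) t ≤∞ X

  realised-∞ : ∀ {a c} → Realised a c ∞
  realised-∞ = inj₁ refl

  realised-here : ∀ a → Realised a a (fin 0ℚ)
  realised-here a = inj₂ (here a , ≤∞-refl)

  realised-edge : ∀ a b → Realised a b (wt∞ G a b)
  realised-edge a b = inj₂ (step a (here b) , ≤∞-reflexive (+∞-identityʳ _))

  realised-+∞ : ∀ {a b c X Y} → Realised a b X → Realised b c Y → Realised a c (X +∞ Y)
  realised-+∞         (inj₁ refl)      _                = inj₁ refl
  realised-+∞ {X = X} _                (inj₁ refl)      = inj₁ (+∞-zeroʳ X)
  realised-+∞         (inj₂ (s , s≤X)) (inj₂ (t , t≤Y)) =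
    inj₂ (s ++ʷ t , ≤∞-trans (≤∞-reflexive (walkWeight-++ (wt∞ G) s t)) (+∞-mono-≤ s≤X t≤Y))

  realised-min∞ : ∀ {a c X Y} → Realised a c X → Realised a c Y → Realised a c (min∞ X Y)
  realised-min∞ {a} {c} {X} {Y} rX rY =
    [ (λ e → subst (Realised a c) (sym e) rX) , (λ e → subst (Realised a c) (sym e) rY) ]′ (min∞-sel X Y)

  realised-sym : ∀ {a c X} → Realised a c X → Realised c a X
  realised-sym (inj₁ X≡∞)      = inj₁ X≡∞
  realised-sym (inj₂ (t , t≤X)) =
    inj₂ (reverseʷ t , ≤∞-trans (≤∞-reflexive (walkWeight-reverse wt∞-symmetric t)) t≤X)

  realised⇒dist≤ : ∀ {a c X d} → Realised a c X → IsDistG G a c d → d ≤∞ X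
  realised⇒dist≤ {d = d} (inj₁ refl)      _              = d ≤∞∞
  realised⇒dist≤         (inj₂ (t , t≤X)) (shortest , _) = ≤∞-trans (shortest t) t≤X

  Sound : Matrix n → Set
  Sound M = ∀ a b → Realised a b (M a b)

  auxGraph-sound : ∀ Ei u {M} → Sound M → Sound (auxGraph Ei u M)
  auxGraph-sound Ei u M-sound a b with Ei a b ∨ isYes (a ≟ u) ∨ isYes (b ≟ u)
  ... | true  = M-sound a b
  ... | false = realised-∞

  walkWeight-realised : ∀ {H} → Sound H → ∀ {a c} (t : Walk a c) → Realised a c (walkWeight H t)
  walkWeight-realised H-sound (here a)       = realised-here a
  walkWeight-realised H-sound (step a {b} t) = realised-+∞ (H-sound a b) (walkWeight-realised H-sound t)

  dist-realised : ∀ {H u y d} → Sound H → IsDist H u y d → Realised u y d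
  dist-realised H-sound (_ , inj₁ d≡∞)        = inj₁ d≡∞
  dist-realised H-sound (_ , inj₂ (t , refl)) = walkWeight-realised H-sound t

  dijkstraStep-sound : ∀ Ei {u M M′} → DijkstraStep Ei u M M′ → Sound M → Sound M′
  dijkstraStep-sound Ei {u} {M} (dist , isDist , refl) M-sound =
    updateWith-elim u dist M (λ x y → Realised x y) M-sound
      (λ y → realised-min∞ (M-sound u y) (dist-u y))
      (λ x → realised-min∞ (M-sound x u) (realised-sym (dist-u x)))
    where
    dist-u : ∀ y → Realised u y (dist y)
    dist-u y = dist-realised (auxGraph-sound Ei u M-sound) (isDist y)

  pathMax-nonNeg : ∀ {a c} (p : Path G a c) → 0ℚ ℚ.≤ pathMax G p
  pathMax-nonNeg (here a)       = ℚP.≤-refl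
  pathMax-nonNeg (step a q e p) = ℚP.≤-trans (pathMax-nonNeg p) (ℚP.p≤q⊔p q (pathMax G p))

  toWalk : ∀ {a c} → Path G a c → Walk a c
  toWalk (here a)       = here a
  toWalk (step a q e p) = step a (toWalk p)

  AllIn : (Fin n → Fin n → Bool) → ∀ {a c} → Path G a c → Set
  AllIn E (here _)           = ⊤
  AllIn E (step a {b} q e p) = E a b ≡ true × AllIn E p

  allIn-isEdge : ∀ {a c} (p : Path G a c) → AllIn (isEdge G) p
  allIn-isEdge (here _)       = tt
  allIn-isEdge (step a q e p) = cong is-just e , allIn-isEdge p

  auxGraph-≤-edge : ∀ {E u M a b q} → M ⊑ wt∞ G → E a b ≡ true → w a b ≡ just q →
                    auxGraph E u M a b ≤∞ fin q
  auxGraph-≤-edge {E} {u} {M} M⊑wt ab∈E e =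
    ≤∞-trans (≤∞-reflexive (auxGraph-edge E u M ab∈E)) (≤∞-trans (M⊑wt _ _) (≤∞-reflexive (wt∞-just e)))

  toWalk-weight : ∀ {E u M} → M ⊑ wt∞ G → ∀ {a c} (p : Path G a c) → AllIn E p →
                  walkWeight (auxGraph E u M) (toWalk p) ≤∞ fin (pathWeight G p)
  toWalk-weight M⊑wt (here a)       _            = ≤∞-refl
  toWalk-weight {E} M⊑wt (step a q e p) (ab∈E , p∈E) =
    +∞-mono-≤ (auxGraph-≤-edge {E} M⊑wt ab∈E e) (toWalk-weight M⊑wt p p∈E)

  -- {c,b} is the last edge of the path outside E; back is the part of the path from u to c,
  -- reversed and extended by {b,c}, so that the detour can prepend an edge at b.
  record LastOutsideEdge (E : Fin n → Fin n → Bool) (W : ℚ) (u v : Fin n) (len : ℚ) : Set where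
    field
      b c     : Fin n
      q       : ℚ
      edge    : w b c ≡ just q
      outside : E c b ≡ false
      back    : Path G b u
      rest    : Path G b v
      rest-in : AllIn E rest
      q≤W     : q ℚ.≤ W
      back≤W  : pathMax G back ℚ.≤ W
      split   : pathWeight G back +ℚ pathWeight G rest ≡ len

  private
    regroup : ∀ q x y → (q +ℚ x) +ℚ y ≡ x +ℚ (q +ℚ y)
    regroup = solve 3 (λ q x y → (q :+ x) :+ y := x :+ (q :+ y)) refl
      where open ℚSolver.+-*-Solver

  lastOutsideEdge-acc : ∀ E {W a u v} (back : Path G a u) (p : Path G a v) →
                        pathMax G back ℚ.≤ W → pathMax G p ℚ.≤ W →
                        AllIn E p ⊎ LastOutsideEdge E W u v (pathWeight G back +ℚ pathWeight G p)
  lastOutsideEdge-acc E back (here _) _ _ = inj₁ tt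
  lastOutsideEdge-acc E {W} {u = u} {v} back (step a {b} q e p) back≤W qp≤W =
    extend (lastOutsideEdge-acc E (step b q e′ back) p (ℚP.⊔-lub q≤W back≤W) p≤W)
    where
    e′  = trans (w-sym b a) e
    q≤W = ℚP.≤-trans (ℚP.p≤p⊔q q (pathMax G p)) qp≤W
    p≤W = ℚP.≤-trans (ℚP.p≤q⊔p q (pathMax G p)) qp≤W
    len = pathWeight G back +ℚ (q +ℚ pathWeight G p)

    extend : AllIn E p ⊎ LastOutsideEdge E W u v ((q +ℚ pathWeight G back) +ℚ pathWeight G p) →
             AllIn E (step a q e p) ⊎ LastOutsideEdge E W u v len
    extend (inj₂ later) = inj₂ (subst (LastOutsideEdge E W u v) (regroup q _ _) later)
    extend (inj₁ p-in) with E a b in E-ab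
    ... | true  = inj₁ (refl , p-in)
    ... | false = inj₂ (record
      { b = b ; c = a ; q = q ; edge = e′ ; outside = E-ab
      ; back = step b q e′ back ; rest = p ; rest-in = p-in
      ; q≤W = q≤W ; back≤W = ℚP.⊔-lub q≤W back≤W
      ; split = regroup q (pathWeight G back) (pathWeight G p) })

  lastOutsideEdge : ∀ E {u v} (p : Path G u v) →
                    AllIn E p ⊎ LastOutsideEdge E (pathMax G p) u v (pathWeight G p)
  lastOutsideEdge E {u} p =
    Sum.map₂ (subst (LastOutsideEdge E (pathMax G p) u _) (ℚP.+-identityˡ (pathWeight G p)))
      (lastOutsideEdge-acc E (here u) p (pathMax-nonNeg p) ℚP.≤-refl)

module _ {n : ℕ} {G : Graph n} {k : ℕ} (ex : Execution G k) where
  open Execution ex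
  open Graph G using (w)

  δ̂-preserves : (P : Matrix n → Set) → P (wt∞ G) →
                (∀ Ei {u M M′} → DijkstraStep Ei u M M′ → P M → P M′) →
                ∀ j → j ≤ k → P (δ̂ j)
  δ̂-preserves P P-init step-P zero    _      = subst P (sym δ̂-init) P-init
  δ̂-preserves P P-init step-P (suc j) 1+j≤k =
    runs-preserves P step-P (δ̂-step (suc j) (s≤s z≤n) 1+j≤k)
      (δ̂-preserves P P-init step-P j (ℕP.<⇒≤ 1+j≤k))

  δ̂-⊑ : ∀ j → j ≤ k → δ̂ j ⊑ wt∞ G
  δ̂-⊑ = δ̂-preserves (_⊑ wt∞ G) ⊑-refl (λ Ei st M⊑wt → ⊑-trans (dijkstraStep-⊑ Ei st) M⊑wt)

  δ̂-symmetric : ∀ j → j ≤ k → IsSymmetric (δ̂ j)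
  δ̂-symmetric = δ̂-preserves IsSymmetric (wt∞-symmetric G)
    (λ { _ {u} {M} (dist , _ , refl) M-sym → updateWith-symmetric u dist M M-sym })

  δ̂-sound : ∀ j → j ≤ k → Sound G (δ̂ j)
  δ̂-sound = δ̂-preserves (Sound G) (realised-edge G) (dijkstraStep-sound G)

  UpperBound : ℕ → Set
  UpperBound j = ∀ {u} → u ∈ D (suc j) → ∀ {v} (p : Path G u v) →
                 δ̂ (suc j) u v ≤∞ fin (pathWeight G p +ℚ twice j *ℚ pathMax G p)

  along-path : ∀ j → suc j ≤ k → ∀ {u} → u ∈ D (suc j) → ∀ {v} (p : Path G u v) →
               AllIn G (Eset G L (suc j)) p →
               δ̂ (suc j) u v ≤∞ fin (pathWeight G p +ℚ twice j *ℚ pathMax G p)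
  along-path j 1+j≤k u∈D p p-in with runs-row-bound (δ̂-step (suc j) (s≤s z≤n) 1+j≤k) u∈D
  ... | Mᵤ , Mᵤ⊑ , row-bound =
    ≤∞-trans (row-bound (toWalk G p))
      (≤∞-trans (toWalk-weight G (⊑-trans Mᵤ⊑ (δ̂-⊑ j (ℕP.<⇒≤ 1+j≤k))) p p-in)
        (fin≤fin (≤-+-twice-* j (pathWeight G p) (pathMax-nonNeg G p))))

  outside-edge-hit : ∀ j → suc (suc j) ≤ k → ∀ {b c q} → w b c ≡ just q → Eset G L (suc (suc j)) c b ≡ false →
                     Σ (Fin n) λ x → x ∈ D (suc j) × Eset G L (suc (suc j)) x b ≡ true ×
                       Σ ℚ λ qx → w x b ≡ just qx × qx ℚ.≤ q
  outside-edge-hit j 2+j≤k {b} {c} bc outside =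
    x , x∈D , xb∈E , qx , trans (Graph.sym G x b) bx , qx≤q
    where
    lightest = L-ok (suc j) (s≤s z≤n) 2+j≤k
    bc∈E : isEdge G b c ≡ true
    bc∈E = cong is-just bc
    c∉L : L (suc j) b c ≡ false
    c∉L = ∨-conicalʳ (L (suc j) c b) (L (suc j) b c) outside
    hit = D-hit (suc j) (s≤s z≤n) 2+j≤k b (lightest-excludes⇒s≤deg {G = G} {L = L (suc j)} lightest bc∈E c∉L)
    x = proj₁ hit
    x∈D = proj₁ (proj₂ hit)
    x∈L = proj₂ (proj₂ hit)
    xb∈E : Eset G L (suc (suc j)) x b ≡ true
    xb∈E = subst (λ t → L (suc j) x b ∨ t ≡ true) (sym x∈L) (∨-zeroʳ (L (suc j) x b))
    bx-weight = is-just⇒just (w b x) (proj₁ (lightest b) x x∈L)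
    qx = proj₁ bx-weight
    bx = proj₂ bx-weight
    qx≤q = fin≤fin⁻¹ (subst₂ _≤∞_ (wt∞-just G bx) (wt∞-just G bc) (proj₂ (proj₂ (lightest b)) x c x∈L c∉L bc∈E))

  detour : ∀ j → suc (suc j) ≤ k → UpperBound j → ∀ {u} → u ∈ D (suc (suc j)) → ∀ {v} (p : Path G u v) →
           LastOutsideEdge G (Eset G L (suc (suc j))) (pathMax G p) u v (pathWeight G p) →
           δ̂ (suc (suc j)) u v ≤∞ fin (pathWeight G p +ℚ twice (suc j) *ℚ pathMax G p)
  detour j 2+j≤k upper {u} u∈D {v} p last
    with runs-row-bound (δ̂-step (suc (suc j)) (s≤s z≤n) 2+j≤k) u∈D
       | outside-edge-hit j 2+j≤k (LastOutsideEdge.edge last) (LastOutsideEdge.outside last)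
  ... | Mᵤ , Mᵤ⊑ , row-bound | x , x∈D , xb∈E , qx , xb , qx≤q = begin
    δ̂ (suc (suc j)) u v
      ≲⟨ row-bound (step u (step x (toWalk G rest))) ⟩
    aux u x +∞ (aux x b +∞ walkWeight aux (toWalk G rest))
      ≲⟨ +∞-mono-≤ ux≤ (+∞-mono-≤ (auxGraph-≤-edge G {E} Mᵤ⊑wt xb∈E xb) (toWalk-weight G Mᵤ⊑wt rest rest-in)) ⟩
    fin (qx +ℚ pathWeight G back +ℚ twice j *ℚ W) +∞ fin (qx +ℚ pathWeight G rest)
      ≲⟨ fin≤fin (detour-≤ j (ℚP.≤-trans qx≤q q≤W)) ⟩
    fin (pathWeight G back +ℚ pathWeight G rest +ℚ twice (suc j) *ℚ W)
      ≡⟨ cong (λ len → fin (len +ℚ twice (suc j) *ℚ W)) split ⟩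
    fin (pathWeight G p +ℚ twice (suc j) *ℚ W) ∎
    where
    open ≤∞-Reasoning
    open LastOutsideEdge last
    W = pathMax G p
    E = Eset G L (suc (suc j))
    aux = auxGraph E u Mᵤ
    Mᵤ⊑wt = ⊑-trans Mᵤ⊑ (δ̂-⊑ (suc j) (ℕP.<⇒≤ 2+j≤k))
    ux≤ : aux u x ≤∞ fin (qx +ℚ pathWeight G back +ℚ twice j *ℚ W)
    ux≤ = begin
      aux u x                     ≡⟨ auxGraph-row E u Mᵤ x ⟩
      Mᵤ u x                      ≲⟨ Mᵤ⊑ u x ⟩
      δ̂ (suc j) u x               ≡⟨ δ̂-symmetric (suc j) (ℕP.<⇒≤ 2+j≤k) u x ⟩
      δ̂ (suc j) x u               ≲⟨ upper x∈D (step x qx xb back) ⟩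
      fin (qx +ℚ pathWeight G back +ℚ twice j *ℚ (qx ℚ.⊔ pathMax G back))
        ≲⟨ fin≤fin (ℚP.+-monoʳ-≤ (qx +ℚ pathWeight G back)
                     (twice-*-mono-≤ j (ℚP.⊔-lub (ℚP.≤-trans qx≤q q≤W) back≤W))) ⟩
      fin (qx +ℚ pathWeight G back +ℚ twice j *ℚ W) ∎

  upper-bound : ∀ j → suc j ≤ k → UpperBound j
  upper-bound zero    1≤k   u∈D p = along-path zero 1≤k u∈D p (allIn-isEdge G p)
  upper-bound (suc j) 2+j≤k u∈D p with lastOutsideEdge G (Eset G L (suc (suc j))) p
  ... | inj₁ p-in = along-path (suc j) 2+j≤k u∈D p p-in
  ... | inj₂ last = detour j 2+j≤k (upper-bound j (ℕP.<⇒≤ 2+j≤k)) u∈D p last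

lemma7p1 : ∀ {n : ℕ} (G : Graph n) (k : ℕ) → 2 ≤ k → (ex : Execution G k) →
    ∀ (i : ℕ) → 1 ≤ i → i ≤ k →
    ∀ (u : Fin n) → u ∈ Execution.D ex i → ∀ (v : Fin n) → (p : Path G u v) →
      (∀ d → IsDistG G u v d → d ≤∞ Execution.δ̂ ex i u v)
      × (Execution.δ̂ ex i u v ≤∞ fin (pathWeight G p +ℚ (((+ (2 * (i ∸ 1))) / 1) *ℚ pathMax G p)))
lemma7p1 G k _ ex (suc j) (s≤s z≤n) 1+j≤k u u∈D v p =
  (λ d isDist → realised⇒dist≤ G (δ̂-sound ex (suc j) 1+j≤k u v) isDist) ,
  upper-bound ex j 1+j≤k u∈D p
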